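{- For a simple connected finite graph $G$, $h(T(G))=|E(G)|$ if and only if $G$ has no internal vertices.
   Context: An internal vertex of $G$ is a vertex of degree at least $2$ (i.e. adjacent to at least two vertices). The total graph $T(G)$ has vertex set $V(G)\cup E(G)$, two elements being adjacent in $T(G)$ if and only if they are adjacent or incident in $G$ (two vertices adjacent in $G$, two edges sharing an endpoint, or a vertex and an edge incident to it). The primitive hole number $h(H)$ of a graph $H$ is the number of triangles (cycles $C_3$) in $H$, with $h(H)=0$ if there are none. -}

module Defs where

open import Data.Bool using (Bool; true; false; _∧_; _∨_; not; T)
open import Data.Nat using (ℕ; suc; _≤_; _<ᵇ_; _+_)
open import Data.Fin using (Fin; toℕ; splitAt; _≟_)
open import Data.List using (List; []; _∷_; length; concatMap; allFin; lookup)
open import Data.Product using (_×_; _,_)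
open import Data.Sum using (_⊎_; inj₁; inj₂)
open import Relation.Nullary using (¬_)
open import Relation.Nullary.Decidable using (⌊_⌋)
open import Relation.Binary.PropositionalEquality using (_≡_)

record SimpleGraph (n : ℕ) : Set where
  field
    adj    : Fin n → Fin n → Bool
    sym    : ∀ i j → adj i j ≡ adj j i
    irrefl : ∀ i → adj i i ≡ false
open SimpleGraph public

_==_ : ∀ {n} → Fin n → Fin n → Bool
i == j = ⌊ i ≟ j ⌋

_<F_ : ∀ {n} → Fin n → Fin n → Bool
i <F j = toℕ i <ᵇ toℕ j

filterᵇ : ∀ {A : Set} → (A → Bool) → List A → List A
filterᵇ p []       = []
filterᵇ p (x ∷ xs) with p x
... | true  = x ∷ filterᵇ p xs
... | false = filterᵇ p xs

count : ∀ {A : Set} → (A → Bool) → List A → ℕ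
count p xs = length (filterᵇ p xs)

data Walk {n : ℕ} (G : SimpleGraph n) : Fin n → Fin n → Set where
  here : ∀ {u} → Walk G u u
  step : ∀ {u w v} → T (adj G u w) → Walk G w v → Walk G u v

Connected : ∀ {n} → SimpleGraph n → Set
Connected {n} G = ∀ (u v : Fin n) → Walk G u v

degree : ∀ {n} → SimpleGraph n → Fin n → ℕ
degree {n} G v = count (adj G v) (allFin n)

IsInternal : ∀ {n} → SimpleGraph n → Fin n → Set
IsInternal G v = 2 ≤ degree G v

NoInternalVertices : ∀ {n} → SimpleGraph n → Set
NoInternalVertices {n} G = ∀ (v : Fin n) → ¬ IsInternal G v

edgeList : ∀ {n} → SimpleGraph n → List (Fin n × Fin n)
edgeList {n} G =
  filterᵇ (λ { (i , j) → (i <F j) ∧ adj G i j })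
          (concatMap (λ i → concatMap (λ j → (i , j) ∷ []) (allFin n)) (allFin n))

numEdges : ∀ {n} → SimpleGraph n → ℕ
numEdges G = length (edgeList G)

-- Total graph T(G): vertex set Fin n ⊎ (indices of edges), encoded as Fin (n + |E|)
private
  share : ∀ {n} → Fin n × Fin n → Fin n × Fin n → Bool
  share (a , b) (c , d) = (a == c) ∨ (a == d) ∨ (b == c) ∨ (b == d)

  incident : ∀ {n} → Fin n → Fin n × Fin n → Bool
  incident u (a , b) = (u == a) ∨ (u == b)

totalAdj : ∀ {n} (G : SimpleGraph n) → Fin (n + numEdges G) → Fin (n + numEdges G) → Bool
totalAdj {n} G x y with splitAt n x | splitAt n y
... | inj₁ u | inj₁ v = adj G u v
... | inj₁ u | inj₂ f = incident u (lookup (edgeList G) f)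
... | inj₂ e | inj₁ v = incident v (lookup (edgeList G) e)
... | inj₂ e | inj₂ f = not (e == f) ∧ share (lookup (edgeList G) e) (lookup (edgeList G) f)

-- Primitive hole number: number of triangles {i,j,k} (i<j<k pairwise adjacent)
-- in a graph on Fin m given by its adjacency relation.
h : ∀ {m} → (Fin m → Fin m → Bool) → ℕ
h {m} A = count (λ { (i , j , k) → (i <F j) ∧ (j <F k) ∧ A i j ∧ A j k ∧ A i k })
  (concatMap (λ i → concatMap (λ j → concatMap (λ k → (i , j , k) ∷ []) (allFin m)) (allFin m)) (allFin m))

-- (⇒) Every edge e = ab of G gives the triangle {a, b, e} of the total graph T(G); these
-- |E(G)| triangles are distinct.  If v is internal, two different edges e₁, e₂ at v give one
-- more triangle {v, e₁, e₂}, so h(T(G)) ≥ |E(G)| + 1.  Triangles are counted by injecting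
-- Fin k into the filtered list of triples (pigeonhole), see count-≥ and h-≥.
-- (⇐) Without internal vertices every vertex has at most one neighbour, so a connected G has
-- at most two vertices: with a the neighbour of 0, the set {0, a} is closed under adjacency
-- and contains every vertex.  On 0 or 1 vertices both sides are 0; on 2 vertices G has the
-- adjacency of K₂, and h(T(K₂)) = 1 = |E(K₂)| by computation.  Since graphs are records with
-- adjacency functions, transferring from G to K₂ uses that h(T(G)) and E(G) only depend on
-- the adjacency relation pointwise (h-totalAdj-cong, edgeList-cong).
module Submission where

open import Defs
open import Data.Nat using (ℕ)
open import Data.Product using (_×_)
open import Relation.Binary.PropositionalEquality using (_≡_)

open import Data.Bool using (Bool; true; false; T; not; _∧_; _∨_)
open import Data.Bool.Properties using (T-∧; T-∨; T-≡)
open import Data.Nat using (suc; _+_; _≤_; _<_; _≤?_; s≤s; z≤n)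
open import Data.Nat.Properties using (≰⇒>; <⇒<ᵇ; <ᵇ⇒<; <-irrefl; <-cmp; ≤-trans; m≤m+n; +-monoʳ-<)
open import Data.Fin using (Fin; zero; suc; toℕ; splitAt; _↑ˡ_; _↑ʳ_; _≟_)
open import Data.Fin.Properties
  using (pigeonhole; splitAt-↑ˡ; splitAt-↑ʳ; toℕ-↑ˡ; toℕ-↑ʳ; ↑ʳ-injective; toℕ-injective; toℕ<n)
open import Data.List using (List; []; _∷_; length; lookup; filter; concatMap; allFin)
open import Data.List.Membership.Propositional using (_∈_; lose)
open import Data.List.Membership.Propositional.Properties
  using (∈-filter⁺; ∈-filter⁻; ∈-concatMap⁺; ∈-allFin; ∈-lookup)
open import Data.List.Relation.Unary.Any using (here; there; index)
open import Data.List.Relation.Unary.Any.Properties using (lookup-index)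
open import Data.List.Relation.Unary.All using (_∷_)
open import Data.List.Relation.Unary.AllPairs using (_∷_)
open import Data.List.Relation.Unary.Unique.Propositional using (Unique)
open import Data.List.Relation.Unary.Unique.Propositional.Properties using (allFin⁺; filter⁺)
open import Data.Product using (Σ; ∃; _,_; proj₁; proj₂)
open import Data.Sum using (_⊎_; inj₁; inj₂)
open import Data.Empty using (⊥-elim)
open import Function using (_∘_)
open import Function.Bundles using (Equivalence)
open import Relation.Nullary using (¬_; yes; no; contradiction)
open import Relation.Nullary.Decidable using (T?; fromWitness; fromWitnessFalse)
open import Relation.Binary.Definitions using (tri<; tri≈; tri>)
open import Relation.Binary.PropositionalEquality
  using (_≢_; refl; trans; cong; cong₂; subst; subst₂; module ≡-Reasoning) renaming (sym to ≡-sym)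

-- Introduction rules for Boolean conjunction, disjunction and Fin equality, read through T.
-- The first conjunct/disjunct is explicit because T (x ∧ y) does not determine x.
∧-intro : ∀ x {y} → T x → T y → T (x ∧ y)
∧-intro x p q = Equivalence.from T-∧ (p , q)

∨-introˡ : ∀ {x} y → T x → T (x ∨ y)
∨-introˡ y p = Equivalence.from T-∨ (inj₁ p)

∨-introʳ : ∀ x {y} → T y → T (x ∨ y)
∨-introʳ x q = Equivalence.from T-∨ (inj₂ q)

==-refl : ∀ {n} (a : Fin n) → T (a == a)
==-refl a = fromWitness refl

-- Boolean filtering agrees with the library's filter on the reflected predicate T ∘ p,
-- so the library's membership and uniqueness facts about filter apply to filterᵇ.
filterᵇ≡filter : ∀ {A : Set} (p : A → Bool) (xs : List A) → filterᵇ p xs ≡ filter (T? ∘ p) xs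
filterᵇ≡filter p [] = refl
filterᵇ≡filter p (x ∷ xs) with p x
... | true  = cong (x ∷_) (filterᵇ≡filter p xs)
... | false = filterᵇ≡filter p xs

module _ {A : Set} (p : A → Bool) {xs : List A} where

  ∈-filterᵇ⁺ : ∀ {x} → x ∈ xs → T (p x) → x ∈ filterᵇ p xs
  ∈-filterᵇ⁺ x∈ px = subst (_ ∈_) (≡-sym (filterᵇ≡filter p xs)) (∈-filter⁺ (T? ∘ p) x∈ px)

  ∈-filterᵇ⁻ : ∀ {x} → x ∈ filterᵇ p xs → x ∈ xs × T (p x)
  ∈-filterᵇ⁻ x∈ = ∈-filter⁻ (T? ∘ p) (subst (_ ∈_) (filterᵇ≡filter p xs) x∈)

  filterᵇ-unique : Unique xs → Unique (filterᵇ p xs)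
  filterᵇ-unique u = subst Unique (≡-sym (filterᵇ≡filter p xs)) (filter⁺ (T? ∘ p) u)

  -- Counting by injection: k distinct elements of xs satisfying p give count p xs ≥ k
  -- (otherwise two of them would land on the same position of the filtered list).
  count-≥ : ∀ k (f : Fin k → A) → (∀ i j → f i ≡ f j → i ≡ j) →
            (∀ i → f i ∈ xs) → (∀ i → T (p (f i))) → k ≤ count p xs
  count-≥ k f f-inj f∈ pf with k ≤? count p xs
  ... | yes k≤ = k≤
  ... | no k≰  = collision (pigeonhole (≰⇒> k≰) position)
    where
    member : ∀ i → f i ∈ filterᵇ p xs
    member i = ∈-filterᵇ⁺ (f∈ i) (pf i)
    position : Fin k → Fin (count p xs)
    position i = index (member i)
    collision : ∃ (λ i → ∃ λ j → toℕ i < toℕ j × position i ≡ position j) → k ≤ count p xs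
    collision (i , j , i<j , same) =
      contradiction (f-inj i j fi≡fj) (λ i≡j → <-irrefl (cong toℕ i≡j) i<j)
      where
      open ≡-Reasoning
      fi≡fj : f i ≡ f j
      fi≡fj = begin
        f i                                ≡⟨ lookup-index (member i) ⟩
        lookup (filterᵇ p xs) (position i) ≡⟨ cong (lookup (filterᵇ p xs)) same ⟩
        lookup (filterᵇ p xs) (position j) ≡⟨ ≡-sym (lookup-index (member j)) ⟩
        f j                                ∎

filterᵇ-cong : ∀ {A : Set} {p q : A → Bool} → (∀ x → p x ≡ q x) →
               ∀ xs → filterᵇ p xs ≡ filterᵇ q xs
filterᵇ-cong p≗q [] = refl
filterᵇ-cong {p = p} {q} p≗q (x ∷ xs) with p x | q x | p≗q x
... | true  | true  | _ = cong (x ∷_) (filterᵇ-cong p≗q xs)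
... | false | false | _ = filterᵇ-cong p≗q xs

member⇒nonempty : ∀ {A : Set} {x : A} {xs : List A} → x ∈ xs → 1 ≤ length xs
member⇒nonempty (here _)  = s≤s z≤n
member⇒nonempty (there _) = s≤s z≤n

two-members⇒length≥2 : ∀ {A : Set} {x y : A} {xs : List A} →
                       x ≢ y → x ∈ xs → y ∈ xs → 2 ≤ length xs
two-members⇒length≥2 x≢y (here refl) (here refl) = ⊥-elim (x≢y refl)
two-members⇒length≥2 _   (here _)    (there y∈) = s≤s (member⇒nonempty y∈)
two-members⇒length≥2 _   (there x∈)  _          = s≤s (member⇒nonempty x∈)

length≥2⇒two-members : ∀ {A : Set} {xs : List A} → Unique xs → 2 ≤ length xs →
                       Σ A λ x → Σ A λ y → x ≢ y × x ∈ xs × y ∈ xs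
length≥2⇒two-members {xs = x ∷ y ∷ _} ((x≢y ∷ _) ∷ _) _ =
  x , y , x≢y , here refl , there (here refl)
length≥2⇒two-members {xs = _ ∷ []} _ (s≤s ())

∈-concatMap : ∀ {A B : Set} (f : A → List B) {xs : List A} {a : A} {y : B} →
              a ∈ xs → y ∈ f a → y ∈ concatMap f xs
∈-concatMap f a∈ y∈ = ∈-concatMap⁺ f (lose a∈ y∈)

ordered-pair : ∀ {k} (P : Fin k → Set) {a b} → a ≢ b → P a → P b →
               Σ (Fin k) λ i → Σ (Fin k) λ j → toℕ i < toℕ j × P i × P j
ordered-pair P {a} {b} a≢b pa pb with <-cmp (toℕ a) (toℕ b)
... | tri< a<b _ _ = a , b , a<b , pa , pb
... | tri≈ _ a≡b _ = contradiction (toℕ-injective a≡b) a≢b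
... | tri> _ _ b<a = b , a , b<a , pb , pa

-- The ordered triples over Fin M enumerated by h, and the triangle test h applies to them
-- (definitionally the one in Defs).
triples : ∀ M → List (Fin M × Fin M × Fin M)
triples M =
  concatMap (λ i → concatMap (λ j → concatMap (λ k → (i , j , k) ∷ []) (allFin M)) (allFin M)) (allFin M)

isTriangle : ∀ {M} → (Fin M → Fin M → Bool) → Fin M × Fin M × Fin M → Bool
isTriangle A (i , j , k) = (i <F j) ∧ (j <F k) ∧ A i j ∧ A j k ∧ A i k

∈-triples : ∀ {M} (t : Fin M × Fin M × Fin M) → t ∈ triples M
∈-triples {M} (i , j , k) =
  ∈-concatMap _ (∈-allFin i) (∈-concatMap _ (∈-allFin j) (∈-concatMap _ (∈-allFin k) (here refl)))

triangle-intro : ∀ {M} (A : Fin M → Fin M → Bool) {i j k} →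
                 T (i <F j) → T (j <F k) → T (A i j) → T (A j k) → T (A i k) →
                 T (isTriangle A (i , j , k))
triangle-intro A {i} {j} {k} i<j j<k ij jk ik =
  ∧-intro (i <F j) i<j (∧-intro (j <F k) j<k (∧-intro (A i j) ij (∧-intro (A j k) jk ik)))

h-≥ : ∀ {M} (A : Fin M → Fin M → Bool) k (t : Fin k → Fin M × Fin M × Fin M) →
      (∀ i j → t i ≡ t j → i ≡ j) → (∀ i → T (isTriangle A (t i))) → k ≤ h A
h-≥ A k t t-inj t-tri = count-≥ (isTriangle A) k t t-inj (∈-triples ∘ t) t-tri

h-cong : ∀ {M} {A B : Fin M → Fin M → Bool} → (∀ x y → A x y ≡ B x y) → h A ≡ h B
h-cong {M} {A} {B} A≗B = cong length (filterᵇ-cong same-test (triples M))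
  where
  same-test : ∀ t → isTriangle A t ≡ isTriangle B t
  same-test (i , j , k) rewrite A≗B i j | A≗B j k | A≗B i k = refl

-- Incidence of a vertex with an edge, and of two edges, as used by totalAdj
-- (definitionally the private helpers of Defs).
incidentᵇ : ∀ {n} → Fin n → Fin n × Fin n → Bool
incidentᵇ u (a , b) = (u == a) ∨ (u == b)

shareᵇ : ∀ {n} → Fin n × Fin n → Fin n × Fin n → Bool
shareᵇ (a , b) (c , d) = (a == c) ∨ (a == d) ∨ (b == c) ∨ (b == d)

totalAdjOn : ∀ {n} (A : Fin n → Fin n → Bool) (L : List (Fin n × Fin n)) →
             Fin n ⊎ Fin (length L) → Fin n ⊎ Fin (length L) → Bool
totalAdjOn A L (inj₁ u) (inj₁ v) = A u v
totalAdjOn A L (inj₁ u) (inj₂ f) = incidentᵇ u (lookup L f)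
totalAdjOn A L (inj₂ e) (inj₁ v) = incidentᵇ v (lookup L e)
totalAdjOn A L (inj₂ e) (inj₂ f) = not (e == f) ∧ shareᵇ (lookup L e) (lookup L f)

totalAdj-unfold : ∀ {n} (G : SimpleGraph n) x y →
                  totalAdj G x y ≡ totalAdjOn (adj G) (edgeList G) (splitAt n x) (splitAt n y)
totalAdj-unfold {n} G x y with splitAt n x | splitAt n y
... | inj₁ u | inj₁ v = refl
... | inj₁ u | inj₂ f = refl
... | inj₂ e | inj₁ v = refl
... | inj₂ e | inj₂ f = refl

isEdgeCode : ∀ {n} → SimpleGraph n → Fin n × Fin n → Bool
isEdgeCode G (i , j) = (i <F j) ∧ adj G i j

pairs : ∀ n → List (Fin n × Fin n)
pairs n = concatMap (λ i → concatMap (λ j → (i , j) ∷ []) (allFin n)) (allFin n)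

∈-pairs : ∀ {n} (i j : Fin n) → (i , j) ∈ pairs n
∈-pairs i j = ∈-concatMap _ (∈-allFin i) (∈-concatMap _ (∈-allFin j) (here refl))

-- Two graphs with pointwise equal adjacency have the same edge list and the same h(T(G)).
-- (Needed because, without function extensionality, they need not be equal as records.)
module _ {n} (G G′ : SimpleGraph n) (adj≗ : ∀ i j → adj G i j ≡ adj G′ i j) where

  edgeList-cong : edgeList G ≡ edgeList G′
  edgeList-cong = filterᵇ-cong same-code (pairs n)
    where
    same-code : ∀ P → isEdgeCode G P ≡ isEdgeCode G′ P
    same-code (i , j) = cong ((i <F j) ∧_) (adj≗ i j)

  h-totalAdj-cong : h (totalAdj G) ≡ h (totalAdj G′)
  h-totalAdj-cong = begin
    h (totalAdj G)                         ≡⟨ h-cong (totalAdj-unfold G) ⟩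
    h (unfolded (adj G) (edgeList G))      ≡⟨ h-cong (λ x y → same-on (splitAt n x) (splitAt n y)) ⟩
    h (unfolded (adj G′) (edgeList G))     ≡⟨ cong (h ∘ unfolded (adj G′)) edgeList-cong ⟩
    h (unfolded (adj G′) (edgeList G′))    ≡⟨ ≡-sym (h-cong (totalAdj-unfold G′)) ⟩
    h (totalAdj G′)                        ∎
    where
    open ≡-Reasoning
    unfolded : (A : Fin n → Fin n → Bool) (L : List (Fin n × Fin n)) →
               Fin (n + length L) → Fin (n + length L) → Bool
    unfolded A L x y = totalAdjOn A L (splitAt n x) (splitAt n y)
    same-on : ∀ s t → totalAdjOn (adj G) (edgeList G) s t ≡ totalAdjOn (adj G′) (edgeList G) s t
    same-on (inj₁ u) (inj₁ v) = adj≗ u v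
    same-on (inj₁ u) (inj₂ f) = refl
    same-on (inj₂ e) (inj₁ v) = refl
    same-on (inj₂ e) (inj₂ f) = refl

adj⇒≢ : ∀ {n} (G : SimpleGraph n) {v x} → T (adj G v x) → x ≢ v
adj⇒≢ G {v} vx refl = subst T (irrefl G v) vx

neighbours : ∀ {n} → SimpleGraph n → Fin n → List (Fin n)
neighbours {n} G v = filterᵇ (adj G v) (allFin n)

module _ {n} (G : SimpleGraph n) {v : Fin n} where

  ∈-neighbours⁺ : ∀ {x} → T (adj G v x) → x ∈ neighbours G v
  ∈-neighbours⁺ vx = ∈-filterᵇ⁺ (adj G v) (∈-allFin _) vx

  ∈-neighbours⁻ : ∀ {x} → x ∈ neighbours G v → T (adj G v x)
  ∈-neighbours⁻ x∈ = proj₂ (∈-filterᵇ⁻ (adj G v) {allFin n} x∈)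

  neighbours-unique : Unique (neighbours G v)
  neighbours-unique = filterᵇ-unique (adj G v) (allFin⁺ n)

  internal⇒two-neighbours : IsInternal G v →
                            Σ (Fin n) λ x → Σ (Fin n) λ y → x ≢ y × T (adj G v x) × T (adj G v y)
  internal⇒two-neighbours internal with length≥2⇒two-members neighbours-unique internal
  ... | x , y , x≢y , x∈ , y∈ = x , y , x≢y , ∈-neighbours⁻ x∈ , ∈-neighbours⁻ y∈

  two-neighbours⇒internal : ∀ {x y} → x ≢ y → T (adj G v x) → T (adj G v y) → IsInternal G v
  two-neighbours⇒internal x≢y vx vy = two-members⇒length≥2 x≢y (∈-neighbours⁺ vx) (∈-neighbours⁺ vy)

Joins : ∀ {n} → Fin n → Fin n → Fin n × Fin n → Set
Joins v x P = P ≡ (v , x) ⊎ P ≡ (x , v)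

joins-incident : ∀ {n} {v x : Fin n} {P} → Joins v x P → T (incidentᵇ v P)
joins-incident {v = v} {x} (inj₁ refl) = ∨-introˡ (v == x) (==-refl v)
joins-incident {v = v} {x} (inj₂ refl) = ∨-introʳ (v == x) (==-refl v)

joins-share : ∀ {n} {v x y : Fin n} {P Q} → Joins v x P → Joins v y Q → T (shareᵇ P Q)
joins-share {v = v} {x} {y} (inj₁ refl) (inj₁ refl) =
  ∨-introˡ ((v == y) ∨ (x == v) ∨ (x == y)) (==-refl v)
joins-share {v = v} {x} {y} (inj₁ refl) (inj₂ refl) =
  ∨-introʳ (v == y) (∨-introˡ ((x == y) ∨ (x == v)) (==-refl v))
joins-share {v = v} {x} {y} (inj₂ refl) (inj₁ refl) =
  ∨-introʳ (x == v) (∨-introʳ (x == y) (∨-introˡ (v == y) (==-refl v)))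
joins-share {v = v} {x} {y} (inj₂ refl) (inj₂ refl) =
  ∨-introʳ (x == y) (∨-introʳ (x == v) (∨-introʳ (v == y) (==-refl v)))

joins-injective : ∀ {n} {v x y : Fin n} {P} → x ≢ v → Joins v x P → Joins v y P → x ≡ y
joins-injective x≢v (inj₁ refl) (inj₁ eq) = cong proj₂ eq
joins-injective x≢v (inj₁ refl) (inj₂ eq) = contradiction (cong proj₂ eq) x≢v
joins-injective x≢v (inj₂ refl) (inj₁ eq) = contradiction (cong proj₁ eq) x≢v
joins-injective x≢v (inj₂ refl) (inj₂ eq) = cong proj₁ eq

∈-edgeList⁻ : ∀ {n} (G : SimpleGraph n) {P} → P ∈ edgeList G →
              toℕ (proj₁ P) < toℕ (proj₂ P) × T (adj G (proj₁ P) (proj₂ P))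
∈-edgeList⁻ {n} G {a , b} listed
  with Equivalence.to T-∧ (proj₂ (∈-filterᵇ⁻ (isEdgeCode G) {pairs n} listed))
... | a<b , ab = <ᵇ⇒< (toℕ a) (toℕ b) a<b , ab

edge-index : ∀ {n} (G : SimpleGraph n) {v x} → T (adj G v x) →
             Σ (Fin (numEdges G)) λ e → Joins v x (lookup (edgeList G) e)
edge-index {n} G {v} {x} vx with <-cmp (toℕ v) (toℕ x)
... | tri< v<x _ _ = index listed , inj₁ (≡-sym (lookup-index listed))
  where
  listed : (v , x) ∈ edgeList G
  listed = ∈-filterᵇ⁺ (isEdgeCode G) (∈-pairs v x) (∧-intro (v <F x) (<⇒<ᵇ v<x) vx)
... | tri≈ _ v≡x _ = contradiction (≡-sym (toℕ-injective v≡x)) (adj⇒≢ G vx)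
... | tri> _ _ x<v = index listed , inj₂ (≡-sym (lookup-index listed))
  where
  listed : (x , v) ∈ edgeList G
  listed = ∈-filterᵇ⁺ (isEdgeCode G) (∈-pairs x v) (∧-intro (x <F v) (<⇒<ᵇ x<v) (subst T (sym G v x) vx))

module TotalGraphTriangles {n} (G : SimpleGraph n) where

  m : ℕ
  m = numEdges G

  E : List (Fin n × Fin n)
  E = edgeList G

  vertex : Fin n → Fin (n + m)
  vertex u = u ↑ˡ m

  edge : Fin m → Fin (n + m)
  edge e = n ↑ʳ e

  adjacency-at : ∀ {x y s t} → splitAt n x ≡ s → splitAt n y ≡ t →
                 totalAdj G x y ≡ totalAdjOn (adj G) E s t
  adjacency-at {x} {y} x↦s y↦t = trans (totalAdj-unfold G x y) (cong₂ (totalAdjOn (adj G) E) x↦s y↦t)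

  vertex-vertex : ∀ u v → totalAdj G (vertex u) (vertex v) ≡ adj G u v
  vertex-vertex u v = adjacency-at (splitAt-↑ˡ n u m) (splitAt-↑ˡ n v m)

  vertex-edge : ∀ u f → totalAdj G (vertex u) (edge f) ≡ incidentᵇ u (lookup E f)
  vertex-edge u f = adjacency-at (splitAt-↑ˡ n u m) (splitAt-↑ʳ n m f)

  edge-edge : ∀ e f → totalAdj G (edge e) (edge f) ≡ (not (e == f) ∧ shareᵇ (lookup E e) (lookup E f))
  edge-edge e f = adjacency-at (splitAt-↑ʳ n m e) (splitAt-↑ʳ n m f)

  edge≢vertex : ∀ {f u} → edge f ≢ vertex u
  edge≢vertex {f} {u} eq
    with trans (≡-sym (splitAt-↑ʳ n m f)) (trans (cong (splitAt n) eq) (splitAt-↑ˡ n u m))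
  ... | ()

  vertex<vertex : ∀ {u v} → toℕ u < toℕ v → T (vertex u <F vertex v)
  vertex<vertex {u} {v} u<v = <⇒<ᵇ (subst₂ _<_ (≡-sym (toℕ-↑ˡ u m)) (≡-sym (toℕ-↑ˡ v m)) u<v)

  vertex<edge : ∀ u e → T (vertex u <F edge e)
  vertex<edge u e =
    <⇒<ᵇ (subst₂ _<_ (≡-sym (toℕ-↑ˡ u m)) (≡-sym (toℕ-↑ʳ n e)) (≤-trans (toℕ<n u) (m≤m+n n (toℕ e))))

  edge<edge : ∀ {e f} → toℕ e < toℕ f → T (edge e <F edge f)
  edge<edge {e} {f} e<f = <⇒<ᵇ (subst₂ _<_ (≡-sym (toℕ-↑ʳ n e)) (≡-sym (toℕ-↑ʳ n f)) (+-monoʳ-< n e<f))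

  Triple : Set
  Triple = Fin (n + m) × Fin (n + m) × Fin (n + m)

  IsTriangle : Triple → Set
  IsTriangle t = T (isTriangle (totalAdj G) t)

  edgeTriangle : Fin m → Triple
  edgeTriangle e = vertex (proj₁ (lookup E e)) , vertex (proj₂ (lookup E e)) , edge e

  edgeTriangle-ok : ∀ e → IsTriangle (edgeTriangle e)
  edgeTriangle-ok e with ∈-edgeList⁻ G (∈-lookup e)
  ... | a<b , ab = triangle-intro (totalAdj G) (vertex<vertex a<b) (vertex<edge b e)
                     (subst T (≡-sym (vertex-vertex a b)) ab)
                     (subst T (≡-sym (vertex-edge b e)) (joins-incident {v = b} {a} (inj₂ refl)))
                     (subst T (≡-sym (vertex-edge a e)) (joins-incident {v = a} {b} (inj₁ refl)))
    where
    a = proj₁ (lookup E e)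
    b = proj₂ (lookup E e)

  EdgeAt : Fin n → Fin m → Set
  EdgeAt v e = Σ (Fin n) λ x → Joins v x (lookup E e)

  starTriangle : Fin n → Fin m → Fin m → Triple
  starTriangle v e₁ e₂ = vertex v , edge e₁ , edge e₂

  starTriangle-ok : ∀ {v e₁ e₂} → toℕ e₁ < toℕ e₂ → EdgeAt v e₁ → EdgeAt v e₂ →
                    IsTriangle (starTriangle v e₁ e₂)
  starTriangle-ok {v} {e₁} {e₂} e₁<e₂ (x , vx) (y , vy) =
    triangle-intro (totalAdj G) (vertex<edge v e₁) (edge<edge e₁<e₂)
      (subst T (≡-sym (vertex-edge v e₁)) (joins-incident vx))
      (subst T (≡-sym (edge-edge e₁ e₂)) (∧-intro (not (e₁ == e₂)) e₁≢e₂ (joins-share vx vy)))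
      (subst T (≡-sym (vertex-edge v e₂)) (joins-incident vy))
    where
    e₁≢e₂ : T (not (e₁ == e₂))
    e₁≢e₂ = fromWitnessFalse (λ e₁≡e₂ → <-irrefl (cong toℕ e₁≡e₂) e₁<e₂)

  internal⇒two-edges : ∀ {v} → IsInternal G v →
                       Σ (Fin m) λ e₁ → Σ (Fin m) λ e₂ → toℕ e₁ < toℕ e₂ × EdgeAt v e₁ × EdgeAt v e₂
  internal⇒two-edges {v} internal with internal⇒two-neighbours G internal
  ... | x , y , x≢y , vx , vy with edge-index G vx | edge-index G vy
  ... | e₁ , at₁ | e₂ , at₂ = ordered-pair (EdgeAt v) e₁≢e₂ (x , at₁) (y , at₂)
    where
    e₁≢e₂ : e₁ ≢ e₂
    e₁≢e₂ refl = x≢y (joins-injective (adj⇒≢ G vx) at₁ at₂)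

  -- Hence the m edge triangles and one star triangle are m + 1 different triangles of T(G).
  internal⇒h>m : ∀ {v} → IsInternal G v → suc m ≤ h (totalAdj G)
  internal⇒h>m internal with internal⇒two-edges internal
  ... | e₁ , e₂ , e₁<e₂ , at₁ , at₂ = h-≥ (totalAdj G) (suc m) triangle triangle-injective triangle-ok
    where
    triangle : Fin (suc m) → Triple
    triangle zero    = starTriangle _ e₁ e₂
    triangle (suc e) = edgeTriangle e
    triangle-ok : ∀ i → IsTriangle (triangle i)
    triangle-ok zero    = starTriangle-ok e₁<e₂ at₁ at₂
    triangle-ok (suc e) = edgeTriangle-ok e
    middle : Triple → Fin (n + m)
    middle (_ , j , _) = j
    triangle-injective : ∀ i j → triangle i ≡ triangle j → i ≡ j
    triangle-injective zero    zero    _  = refl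
    triangle-injective zero    (suc f) eq = contradiction (cong middle eq) edge≢vertex
    triangle-injective (suc e) zero    eq = contradiction (≡-sym (cong middle eq)) edge≢vertex
    triangle-injective (suc e) (suc f) eq = cong suc (↑ʳ-injective n e f (cong (proj₂ ∘ proj₂) eq))

unique-neighbour : ∀ {n} (G : SimpleGraph n) → NoInternalVertices G →
                   ∀ {v x y} → T (adj G v x) → T (adj G v y) → x ≡ y
unique-neighbour G no-internal {v} {x} {y} vx vy with x ≟ y
... | yes x≡y = x≡y
... | no  x≢y = contradiction (two-neighbours⇒internal G x≢y vx vy) (no-internal v)

walk-closed : ∀ {n} (G : SimpleGraph n) (S : Fin n → Set) → (∀ {s u} → S s → T (adj G s u) → S u) →
              ∀ {u w} → Walk G u w → S w → S u
walk-closed G S closed here           s = s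
walk-closed G S closed (step uw walk) s = closed (walk-closed G S closed walk s) (subst T (sym G _ _) uw)

-- A connected graph without internal vertices has at most two vertices: if a is the
-- neighbour of vertex 0, then {0, a} is closed under adjacency, so vertices 1 and 2 both equal a.
no-internal-on-three : ∀ k (G : SimpleGraph (3 + k)) → Connected G → ¬ NoInternalVertices G
no-internal-on-three k G connected no-internal with connected zero (suc zero)
... | step {w = a} 0a _ = one≢two (trans (is-a (suc zero) λ ()) (≡-sym (is-a (suc (suc zero)) λ ())))
  where
  one≢two : suc zero ≢ suc (suc zero)
  one≢two ()
  S : Fin (3 + k) → Set
  S u = u ≡ zero ⊎ u ≡ a
  closed : ∀ {s u} → S s → T (adj G s u) → S u
  closed (inj₁ refl) 0u = inj₂ (unique-neighbour G no-internal 0u 0a)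
  closed (inj₂ refl) au = inj₁ (unique-neighbour G no-internal au (subst T (sym G zero a) 0a))
  is-a : ∀ u → u ≢ zero → u ≡ a
  is-a u u≢0 with walk-closed G S closed (connected u zero) (inj₁ refl)
  ... | inj₁ u≡0 = contradiction u≡0 u≢0
  ... | inj₂ u≡a = u≡a

-- The complete graph on two vertices, whose total graph is a single triangle.
K₂ : SimpleGraph 2
K₂ = record { adj = λ i j → not (i == j) ; sym = K₂-sym ; irrefl = K₂-irrefl }
  where
  K₂-sym : ∀ i j → not (i == j) ≡ not (j == i)
  K₂-sym zero       zero       = refl
  K₂-sym zero       (suc zero) = refl
  K₂-sym (suc zero) zero       = refl
  K₂-sym (suc zero) (suc zero) = refl
  K₂-irrefl : ∀ i → not (i == i) ≡ false
  K₂-irrefl zero       = refl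
  K₂-irrefl (suc zero) = refl

connected-two≗K₂ : (G : SimpleGraph 2) → Connected G → ∀ i j → adj G i j ≡ adj K₂ i j
connected-two≗K₂ G connected = adj≗
  where
  edge₀₁ : adj G zero (suc zero) ≡ true
  edge₀₁ with connected zero (suc zero)
  ... | step {w = zero}     loop _ = contradiction refl (adj⇒≢ G loop)
  ... | step {w = suc zero} edge _ = Equivalence.to T-≡ edge
  adj≗ : ∀ i j → adj G i j ≡ adj K₂ i j
  adj≗ zero       zero       = irrefl G zero
  adj≗ zero       (suc zero) = edge₀₁
  adj≗ (suc zero) zero       = trans (sym G (suc zero) zero) edge₀₁
  adj≗ (suc zero) (suc zero) = irrefl G (suc zero)

no-internal⇒h≡m : ∀ {n} (G : SimpleGraph n) → Connected G → NoInternalVertices G →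
                  h (totalAdj G) ≡ numEdges G
no-internal⇒h≡m {0}           G connected no-internal = refl
no-internal⇒h≡m {1}           G connected no-internal = refl
no-internal⇒h≡m {2}           G connected no-internal = begin
  h (totalAdj G)   ≡⟨ h-totalAdj-cong G K₂ G≗K₂ ⟩
  h (totalAdj K₂)  ≡⟨⟩
  1                ≡⟨⟩
  numEdges K₂      ≡⟨ cong length (≡-sym (edgeList-cong G K₂ G≗K₂)) ⟩
  numEdges G       ∎
  where
  open ≡-Reasoning
  G≗K₂ : ∀ i j → adj G i j ≡ adj K₂ i j
  G≗K₂ = connected-two≗K₂ G connected
no-internal⇒h≡m {suc (suc (suc k))} G connected no-internal =
  ⊥-elim (no-internal-on-three k G connected no-internal)

-- (⇒): h(T(G)) = |E(G)| leaves no room for the extra triangle of an internal vertex.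
h≡m⇒no-internal : ∀ {n} (G : SimpleGraph n) → h (totalAdj G) ≡ numEdges G → NoInternalVertices G
h≡m⇒no-internal G h≡m v internal = <-irrefl refl (subst (suc m ≤_) h≡m (internal⇒h>m internal))
  where open TotalGraphTriangles G

theorem2p10 : ∀ {n : ℕ} (G : SimpleGraph n) → Connected G →
    ((h (totalAdj G) ≡ numEdges G → NoInternalVertices G) × (NoInternalVertices G → h (totalAdj G) ≡ numEdges G))
theorem2p10 G connected = h≡m⇒no-internal G , no-internal⇒h≡m G connected
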